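{- Let $G_{81,20}=\{x\in\mathbb{F}_{81}:x^{20}=1\}$. The four cosets of $G_{81,20}$ in $\mathbb{F}_{81}^\times$ form a partition of $\mathbb{F}_{81}^\times$ into $4$ cap sets, each of size $20$, which is the maximum possible size of a cap set in $\mathbb{F}_{81}$.
   Context: For $q=3^m$, a subset $S\subseteq\mathbb{F}_q$ is a cap set if there are no pairwise distinct $a,b,c\in S$ with $a+b+c=0$ (equivalently, $S$ contains no three collinear points of the affine geometry $\mathrm{AG}(m,3)\cong\mathbb{F}_q$). -}

module Defs where

open import Data.Nat using (ℕ; zero; suc)
open import Data.List using (List; length)
open import Data.List.Membership.Propositional using (_∈_)
open import Data.List.Relation.Unary.Unique.Propositional using (Unique)
open import Data.Product using (Σ; _×_)
open import Relation.Binary.PropositionalEquality using (_≡_; _≢_)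
open import Relation.Nullary using (¬_)
open import Function.Bundles using (_⇔_)

data 𝔽₃ : Set where
  c0 c1 c2 : 𝔽₃

_+₃_ : 𝔽₃ → 𝔽₃ → 𝔽₃
c0 +₃ y  = y
c1 +₃ c0 = c1
c1 +₃ c1 = c2
c1 +₃ c2 = c0
c2 +₃ c0 = c2
c2 +₃ c1 = c0
c2 +₃ c2 = c1

_*₃_ : 𝔽₃ → 𝔽₃ → 𝔽₃
c0 *₃ y  = c0
c1 *₃ y  = y
c2 *₃ c0 = c0
c2 *₃ c1 = c2
c2 *₃ c2 = c1

infixl 6 _+₃_
infixl 7 _*₃_

-- 𝔽₈₁ = 𝔽₃[α]/(α⁴ + 2α³ + 2)  (Conway polynomial, irreducible over 𝔽₃).
-- An element  mk a b c d  stands for  a + bα + cα² + dα³,  and α⁴ = α³ + 1.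

record 𝔽₈₁ : Set where
  constructor mk
  field
    e0 e1 e2 e3 : 𝔽₃

open 𝔽₈₁

0F : 𝔽₈₁
0F = mk c0 c0 c0 c0

1F : 𝔽₈₁
1F = mk c1 c0 c0 c0

_+F_ : 𝔽₈₁ → 𝔽₈₁ → 𝔽₈₁
mk a0 a1 a2 a3 +F mk b0 b1 b2 b3 = mk (a0 +₃ b0) (a1 +₃ b1) (a2 +₃ b2) (a3 +₃ b3)

-- product: compute the degree ≤ 6 polynomial product p₀..p₆, then reduce with
-- α⁴ = α³ + 1, α⁵ = α³ + α + 1, α⁶ = α³ + α² + α + 1.
_*F_ : 𝔽₈₁ → 𝔽₈₁ → 𝔽₈₁
mk a0 a1 a2 a3 *F mk b0 b1 b2 b3 =
  mk (p0 +₃ p4 +₃ p5 +₃ p6)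
     (p1 +₃ p5 +₃ p6)
     (p2 +₃ p6)
     (p3 +₃ p4 +₃ p5 +₃ p6)
  where
  p0 = a0 *₃ b0
  p1 = a0 *₃ b1 +₃ a1 *₃ b0
  p2 = a0 *₃ b2 +₃ a1 *₃ b1 +₃ a2 *₃ b0
  p3 = a0 *₃ b3 +₃ a1 *₃ b2 +₃ a2 *₃ b1 +₃ a3 *₃ b0
  p4 = a1 *₃ b3 +₃ a2 *₃ b2 +₃ a3 *₃ b1
  p5 = a2 *₃ b3 +₃ a3 *₃ b2
  p6 = a3 *₃ b3

infixl 6 _+F_
infixl 7 _*F_

_^F_ : 𝔽₈₁ → ℕ → 𝔽₈₁
x ^F zero  = 1F
x ^F suc n = x *F (x ^F n)

Subset : Set₁
Subset = 𝔽₈₁ → Set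

G81,20 : Subset
G81,20 x = x ^F 20 ≡ 1F

coset : 𝔽₈₁ → Subset
coset h x = Σ 𝔽₈₁ (λ y → G81,20 y × x ≡ h *F y)

IsCapSet : Subset → Set
IsCapSet S = ∀ a b c → S a → S b → S c →
  a ≢ b → b ≢ c → a ≢ c → a +F b +F c ≢ 0F

HasSize : Subset → ℕ → Set
HasSize S n = Σ (List 𝔽₈₁) (λ L → Unique L × (∀ x → (x ∈ L) ⇔ S x) × length L ≡ n)

module Submission where

open import Defs
open import Data.Nat using (ℕ; _≤_)
open import Data.Fin using (Fin)
open import Data.Product using (Σ; _×_; ∃-syntax)
open import Relation.Binary.PropositionalEquality using (_≡_; _≢_)
open import Relation.Nullary using (¬_)

import Algebra.Properties.CommutativeSemigroup as CommutativeSemigroupProperties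
open import Data.Bool using (Bool; true; false; T; if_then_else_)
open import Data.Empty using (⊥-elim)
open import Data.Fin using (toℕ)
import Data.Fin.Properties as Fin
open import Data.List using (List; []; _∷_; filter; length; map; cartesianProductWith)
open import Data.List.Membership.Propositional using (_∈_; _∉_)
open import Data.List.Membership.Propositional.Properties
  using (∈-cartesianProductWith⁺; ∈-filter⁺; ∈-filter⁻; ∈-map⁺; ∈-map⁻)
import Data.List.Membership.DecPropositional as DecMembership
open import Data.List.Properties using (length-take; length-map)
open import Data.List.Relation.Binary.Subset.Propositional using (_⊆_)
open import Data.List.Relation.Binary.Subset.Propositional.Properties using (filter-⊆)
open import Data.List.Relation.Binary.Sublist.Propositional.Properties using (take-⊆; Any-resp-⊆)
open import Data.List.Relation.Unary.All using (All; []; _∷_; all?; lookup; zipWith; tabulate)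
open import Data.List.Relation.Unary.All.Properties using (anti-mono; all-filter; filter⁺)
open import Data.List.Relation.Unary.AllPairs using ([]; _∷_; allPairs?)
open import Data.List.Relation.Unary.Any using (here; there)
open import Data.List.Relation.Unary.Unique.Propositional using (Unique)
import Data.List.Relation.Unary.Unique.Propositional.Properties as Unique
open import Data.Nat using (suc; _+_; _*_; _<_; z≤n; _≤?_; _<?_; _≟_)
open import Data.Nat.Divisibility using (divides; _∣?_)
open import Data.Nat.Properties
open import Data.Nat.Tactic.RingSolver using (solve-∀)
open import Data.Product using (_,_; proj₁; proj₂)
open import Data.Product.Function.NonDependent.Propositional using (_×-⇔_)
open import Data.Sum using (_⊎_; inj₁; inj₂)
open import Data.Unit using (tt)
open import Function using (_∘_; _$_; _⇔_; mk⇔; Equivalence)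
import Function.Properties.Equivalence as ⇔
open import Relation.Binary.Definitions using (DecidableEquality)
open import Relation.Binary.PropositionalEquality
open import Relation.Nullary using (Dec; yes; no)
open import Relation.Nullary.Decidable
  using (from-yes; from-no; True; toWitness; map′; T?; ¬?; _→-dec_; _×-dec_; _⊎-dec_)
open import Relation.Unary using (Decidable)

open 𝔽₈₁
open Equivalence using (to; from)
open CommutativeSemigroupProperties +-commutativeSemigroup using (interchange)

-- Identify 𝔽₈₁ with 𝔽₃⁴. The cosets of G_{81,20} are the αⁱ G_{81,20}, i < 4, for a primitive α,
-- and everything about them is decided by computation. The bound 20 is a counting argument by
-- induction on dimension. Each u among the 40 points of PG(3,3) cuts a cap L into three parallel
-- sections of sizes s_u(v). Counting pairs and triples of points of L against the u that do not
-- separate them gives ∑_u ∑_v s_u(v)² and ∑_u ∑_v s_u(v)³ exactly, since a nonzero difference is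
-- orthogonal to 13 points of PG(3,3) and two independent differences to 4. In a plane or a solid,
-- summing only over the u transversal to it and bounding each section by the previous dimension
-- (three points of a line are never a cap) rules out 5 cap points in a plane and 10 in a solid. For
-- 21 points in the whole space the resulting bound 19 ∑_v s_u(v)² ≤ ∑_v s_u(v)³ + 1764 must be tight
-- for every u, forcing ∑_v s_u(v)² ∈ {147, 171}; but then ∑_u ∑_v s_u(v)² = 6300 would be
-- 40 · 147 modulo 24, which it is not.

_≟₃_ : DecidableEquality 𝔽₃
c0 ≟₃ c0 = yes refl
c1 ≟₃ c1 = yes refl
c2 ≟₃ c2 = yes refl
c0 ≟₃ c1 = no λ ()
c0 ≟₃ c2 = no λ ()
c1 ≟₃ c0 = no λ ()
c1 ≟₃ c2 = no λ ()
c2 ≟₃ c0 = no λ ()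
c2 ≟₃ c1 = no λ ()

infix 4 _≟₃_

-₃_ : 𝔽₃ → 𝔽₃
-₃ c0 = c0
-₃ c1 = c2
-₃ c2 = c1

infix 8 -₃_

_-₃_ : 𝔽₃ → 𝔽₃ → 𝔽₃
a -₃ b = a +₃ -₃ b

infixl 6 _-₃_

∀₃? : {P : 𝔽₃ → Set} → Decidable P → Dec (∀ a → P a)
∀₃? P? with P? c0 | P? c1 | P? c2
... | yes p₀ | yes p₁ | yes p₂ = yes λ { c0 → p₀ ; c1 → p₁ ; c2 → p₂ }
... | no ¬p  | _      | _      = no λ p → ¬p (p c0)
... | yes _  | no ¬p  | _      = no λ p → ¬p (p c1)
... | yes _  | yes _  | no ¬p  = no λ p → ¬p (p c2)

*₃-zeroʳ : ∀ a → a *₃ c0 ≡ c0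
*₃-zeroʳ = from-yes (∀₃? λ a → a *₃ c0 ≟₃ c0)

*₃-distribˡ--₃ : ∀ a b c → a *₃ (b -₃ c) ≡ a *₃ b -₃ a *₃ c
*₃-distribˡ--₃ = from-yes (∀₃? λ a → ∀₃? λ b → ∀₃? λ c → a *₃ (b -₃ c) ≟₃ a *₃ b -₃ a *₃ c)

+₃--₃-interchange : ∀ p q r s → (p -₃ q) +₃ (r -₃ s) ≡ (p +₃ r) -₃ (q +₃ s)
+₃--₃-interchange = from-yes (∀₃? λ p → ∀₃? λ q → ∀₃? λ r → ∀₃? λ s →
  (p -₃ q) +₃ (r -₃ s) ≟₃ (p +₃ r) -₃ (q +₃ s))

-₃-involutive : ∀ a → -₃ -₃ a ≡ a
-₃-involutive = from-yes (∀₃? λ a → -₃ -₃ a ≟₃ a)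

x-₃x≡0 : ∀ a → a -₃ a ≡ c0
x-₃x≡0 = from-yes (∀₃? λ a → a -₃ a ≟₃ c0)

x-₃y≡0⇒x≡y : ∀ a b → a -₃ b ≡ c0 → a ≡ b
x-₃y≡0⇒x≡y = from-yes (∀₃? λ a → ∀₃? λ b → (a -₃ b ≟₃ c0) →-dec (a ≟₃ b))

-₃x≡0⇒x≡0 : ∀ a → -₃ a ≡ c0 → a ≡ c0
-₃x≡0⇒x≡0 = from-yes (∀₃? λ a → (-₃ a ≟₃ c0) →-dec (a ≟₃ c0))

-₃-cancelʳ : ∀ a b c → a -₃ c ≡ b -₃ c → a ≡ b
-₃-cancelʳ = from-yes (∀₃? λ a → ∀₃? λ b → ∀₃? λ c → (a -₃ c ≟₃ b -₃ c) →-dec (a ≟₃ b))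

midpoint⇒sum≡0 : ∀ a b c → c -₃ a ≡ -₃ (b -₃ a) → a +₃ b +₃ c ≡ c0
midpoint⇒sum≡0 = from-yes (∀₃? λ a → ∀₃? λ b → ∀₃? λ c →
  (c -₃ a ≟₃ -₃ (b -₃ a)) →-dec (a +₃ b +₃ c ≟₃ c0))

sum≡0⇒third : ∀ a b c → a +₃ b +₃ c ≡ c0 → c ≡ -₃ (a +₃ b)
sum≡0⇒third = from-yes (∀₃? λ a → ∀₃? λ b → ∀₃? λ c → (a +₃ b +₃ c ≟₃ c0) →-dec (c ≟₃ -₃ (a +₃ b)))

𝔽₃-elements : List 𝔽₃
𝔽₃-elements = c0 ∷ c1 ∷ c2 ∷ []

∈-𝔽₃-elements : ∀ a → a ∈ 𝔽₃-elements
∈-𝔽₃-elements c0 = here refl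
∈-𝔽₃-elements c1 = there (here refl)
∈-𝔽₃-elements c2 = there (there (here refl))

-- 𝔽₈₁ as the vector space 𝔽₃⁴

-F_ : 𝔽₈₁ → 𝔽₈₁
-F mk a b c d = mk (-₃ a) (-₃ b) (-₃ c) (-₃ d)

infix 8 -F_

_-F_ : 𝔽₈₁ → 𝔽₈₁ → 𝔽₈₁
mk a0 a1 a2 a3 -F mk b0 b1 b2 b3 = mk (a0 -₃ b0) (a1 -₃ b1) (a2 -₃ b2) (a3 -₃ b3)

infixl 6 _-F_

_·_ : 𝔽₈₁ → 𝔽₈₁ → 𝔽₃
mk a0 a1 a2 a3 · mk b0 b1 b2 b3 = a0 *₃ b0 +₃ a1 *₃ b1 +₃ a2 *₃ b2 +₃ a3 *₃ b3

infix 7 _·_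

≡-componentwise : ∀ {x y} → e0 x ≡ e0 y → e1 x ≡ e1 y → e2 x ≡ e2 y → e3 x ≡ e3 y → x ≡ y
≡-componentwise {mk _ _ _ _} {mk _ _ _ _} refl refl refl refl = refl

_≟F_ : DecidableEquality 𝔽₈₁
mk a0 a1 a2 a3 ≟F mk b0 b1 b2 b3 =
  map′ (λ { (p0 , p1 , p2 , p3) → ≡-componentwise p0 p1 p2 p3 })
       (λ p → cong e0 p , cong e1 p , cong e2 p , cong e3 p)
       (a0 ≟₃ b0 ×-dec a1 ≟₃ b1 ×-dec a2 ≟₃ b2 ×-dec a3 ≟₃ b3)

infix 4 _≟F_

open DecMembership _≟F_ using (_∈?_)

𝔽₈₁-elements : List 𝔽₈₁
𝔽₈₁-elements = cartesianProductWith _$_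
  (cartesianProductWith _$_ (cartesianProductWith mk 𝔽₃-elements 𝔽₃-elements) 𝔽₃-elements) 𝔽₃-elements

∈-𝔽₈₁-elements : ∀ x → x ∈ 𝔽₈₁-elements
∈-𝔽₈₁-elements (mk a b c d) =
  ∈-cartesianProductWith⁺ _$_ (∈-cartesianProductWith⁺ _$_
    (∈-cartesianProductWith⁺ mk (∈-𝔽₃-elements a) (∈-𝔽₃-elements b)) (∈-𝔽₃-elements c)) (∈-𝔽₃-elements d)

·-distribˡ--F : ∀ u x y → u · (x -F y) ≡ u · x -₃ u · y
·-distribˡ--F (mk a b c d) (mk x0 x1 x2 x3) (mk y0 y1 y2 y3) = begin
    a *₃ (x0 -₃ y0) +₃ b *₃ (x1 -₃ y1) +₃ c *₃ (x2 -₃ y2) +₃ d *₃ (x3 -₃ y3)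
  ≡⟨ cong₂ _+₃_ (cong₂ _+₃_ (cong₂ _+₃_ (*₃-distribˡ--₃ a x0 y0) (*₃-distribˡ--₃ b x1 y1))
                                         (*₃-distribˡ--₃ c x2 y2)) (*₃-distribˡ--₃ d x3 y3) ⟩
    (a *₃ x0 -₃ a *₃ y0) +₃ (b *₃ x1 -₃ b *₃ y1) +₃ (c *₃ x2 -₃ c *₃ y2) +₃ (d *₃ x3 -₃ d *₃ y3)
  ≡⟨ cong (λ t → t +₃ (c *₃ x2 -₃ c *₃ y2) +₃ (d *₃ x3 -₃ d *₃ y3))
          (+₃--₃-interchange (a *₃ x0) (a *₃ y0) (b *₃ x1) (b *₃ y1)) ⟩
    (a *₃ x0 +₃ b *₃ x1 -₃ (a *₃ y0 +₃ b *₃ y1)) +₃ (c *₃ x2 -₃ c *₃ y2) +₃ (d *₃ x3 -₃ d *₃ y3)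
  ≡⟨ cong (_+₃ (d *₃ x3 -₃ d *₃ y3))
          (+₃--₃-interchange (a *₃ x0 +₃ b *₃ x1) (a *₃ y0 +₃ b *₃ y1) (c *₃ x2) (c *₃ y2)) ⟩
    (a *₃ x0 +₃ b *₃ x1 +₃ c *₃ x2 -₃ (a *₃ y0 +₃ b *₃ y1 +₃ c *₃ y2)) +₃ (d *₃ x3 -₃ d *₃ y3)
  ≡⟨ +₃--₃-interchange (a *₃ x0 +₃ b *₃ x1 +₃ c *₃ x2) (a *₃ y0 +₃ b *₃ y1 +₃ c *₃ y2) (d *₃ x3) (d *₃ y3) ⟩
    a *₃ x0 +₃ b *₃ x1 +₃ c *₃ x2 +₃ d *₃ x3 -₃ (a *₃ y0 +₃ b *₃ y1 +₃ c *₃ y2 +₃ d *₃ y3)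
  ∎
  where open ≡-Reasoning

·-zeroʳ : ∀ u → u · 0F ≡ c0
·-zeroʳ (mk a b c d) rewrite *₃-zeroʳ a | *₃-zeroʳ b | *₃-zeroʳ c | *₃-zeroʳ d = refl

-- Once d is a constructor, 0F -F d reduces to -F d.
·-negʳ : ∀ u d → u · (-F d) ≡ -₃ (u · d)
·-negʳ u d@(mk _ _ _ _) = trans (·-distribˡ--F u 0F d) (cong (_-₃ u · d) (·-zeroʳ u))

·-agree⇔·-kills : ∀ u x y → (u · x ≡ u · y) ⇔ (u · (x -F y) ≡ c0)
·-agree⇔·-kills u x y = mk⇔
  (λ eq → trans (·-distribˡ--F u x y) (trans (cong (_-₃ u · y) eq) (x-₃x≡0 (u · y))))
  (λ eq → x-₃y≡0⇒x≡y (u · x) (u · y) (trans (sym (·-distribˡ--F u x y)) eq))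

-F-involutive : ∀ x → -F -F x ≡ x
-F-involutive (mk a b c d) =
  ≡-componentwise (-₃-involutive a) (-₃-involutive b) (-₃-involutive c) (-₃-involutive d)

x-Fy≡0⇒x≡y : ∀ x y → x -F y ≡ 0F → x ≡ y
x-Fy≡0⇒x≡y (mk a0 a1 a2 a3) (mk b0 b1 b2 b3) eq =
  ≡-componentwise (x-₃y≡0⇒x≡y a0 b0 (cong e0 eq)) (x-₃y≡0⇒x≡y a1 b1 (cong e1 eq))
                  (x-₃y≡0⇒x≡y a2 b2 (cong e2 eq)) (x-₃y≡0⇒x≡y a3 b3 (cong e3 eq))

-F-cancelʳ : ∀ x y z → x -F z ≡ y -F z → x ≡ y
-F-cancelʳ (mk a0 a1 a2 a3) (mk b0 b1 b2 b3) (mk c0' c1' c2' c3') eq =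
  ≡-componentwise (-₃-cancelʳ a0 b0 c0' (cong e0 eq)) (-₃-cancelʳ a1 b1 c1' (cong e1 eq))
                  (-₃-cancelʳ a2 b2 c2' (cong e2 eq)) (-₃-cancelʳ a3 b3 c3' (cong e3 eq))

midpointF⇒sum≡0 : ∀ x y z → z -F x ≡ -F (y -F x) → x +F y +F z ≡ 0F
midpointF⇒sum≡0 (mk a0 a1 a2 a3) (mk b0 b1 b2 b3) (mk c0' c1' c2' c3') eq =
  ≡-componentwise (midpoint⇒sum≡0 a0 b0 c0' (cong e0 eq)) (midpoint⇒sum≡0 a1 b1 c1' (cong e1 eq))
                  (midpoint⇒sum≡0 a2 b2 c2' (cong e2 eq)) (midpoint⇒sum≡0 a3 b3 c3' (cong e3 eq))

sumF≡0⇒third : ∀ x y z → x +F y +F z ≡ 0F → z ≡ -F (x +F y)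
sumF≡0⇒third (mk a0 a1 a2 a3) (mk b0 b1 b2 b3) (mk c0' c1' c2' c3') eq =
  ≡-componentwise (sum≡0⇒third a0 b0 c0' (cong e0 eq)) (sum≡0⇒third a1 b1 c1' (cong e1 eq))
                  (sum≡0⇒third a2 b2 c2' (cong e2 eq)) (sum≡0⇒third a3 b3 c3' (cong e3 eq))

isNormalised : 𝔽₈₁ → Bool
isNormalised (mk c1 _ _ _)    = true
isNormalised (mk c0 c1 _ _)   = true
isNormalised (mk c0 c0 c1 _)  = true
isNormalised (mk c0 c0 c0 c1) = true
isNormalised _                = false

normalise : 𝔽₈₁ → 𝔽₈₁
normalise d = if isNormalised d then d else -F d

-- One vector from each pair ±d of nonzero vectors, i.e. the 40 points of PG(3,3);
-- u ∈ directions indexes the parallel class of hyperplanes u · x = v.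
directions : List 𝔽₈₁
directions = filter (λ d → T? (isNormalised d)) 𝔽₈₁-elements

normalise-isNormalised : ∀ d → d ≢ 0F → T (isNormalised (normalise d))
normalise-isNormalised (mk c1 _ _ _)    _   = tt
normalise-isNormalised (mk c2 _ _ _)    _   = tt
normalise-isNormalised (mk c0 c1 _ _)   _   = tt
normalise-isNormalised (mk c0 c2 _ _)   _   = tt
normalise-isNormalised (mk c0 c0 c1 _)  _   = tt
normalise-isNormalised (mk c0 c0 c2 _)  _   = tt
normalise-isNormalised (mk c0 c0 c0 c1) _   = tt
normalise-isNormalised (mk c0 c0 c0 c2) _   = tt
normalise-isNormalised (mk c0 c0 c0 c0) d≢0 = ⊥-elim (d≢0 refl)

normalise∈directions : ∀ {d} → d ≢ 0F → normalise d ∈ directions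
normalise∈directions {d} d≢0 =
  ∈-filter⁺ (λ d → T? (isNormalised d)) (∈-𝔽₈₁-elements (normalise d)) (normalise-isNormalised d d≢0)

normalise≡± : ∀ d → normalise d ≡ d ⊎ normalise d ≡ -F d
normalise≡± d with isNormalised d
... | true  = inj₁ refl
... | false = inj₂ refl

normalise-injective± : ∀ a b → normalise a ≡ normalise b → a ≡ b ⊎ a ≡ -F b
normalise-injective± a b eq with normalise≡± a | normalise≡± b
... | inj₁ na | inj₁ nb = inj₁ (trans (sym na) (trans eq nb))
... | inj₁ na | inj₂ nb = inj₂ (trans (sym na) (trans eq nb))
... | inj₂ na | inj₁ nb = inj₂ (trans (sym (-F-involutive a)) (cong -F_ (trans (sym na) (trans eq nb))))
... | inj₂ na | inj₂ nb = inj₁ (begin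
  a          ≡⟨ sym (-F-involutive a) ⟩
  -F -F a    ≡⟨ cong -F_ (trans (sym na) (trans eq nb)) ⟩
  -F -F b    ≡⟨ -F-involutive b ⟩
  b          ∎)
  where open ≡-Reasoning

·-kills-normalise : ∀ u d → u · normalise d ≡ c0 ⇔ u · d ≡ c0
·-kills-normalise u d with normalise≡± d
... | inj₁ nd = mk⇔ (λ p → trans (cong (u ·_) (sym nd)) p) (λ p → trans (cong (u ·_) nd) p)
... | inj₂ nd = mk⇔ (λ p → -₃x≡0⇒x≡0 (u · d) (trans (sym (·-negʳ u d)) (trans (cong (u ·_) (sym nd)) p)))
                    (λ p → trans (cong (u ·_) nd) (trans (·-negʳ u d) (cong -₃_ p)))

projLine : 𝔽₈₁ → 𝔽₈₁ → List 𝔽₈₁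
projLine f g = f ∷ g ∷ normalise (f +F g) ∷ normalise (f -F g) ∷ []

orthogonal : 𝔽₈₁ → List 𝔽₈₁ → List 𝔽₈₁
orthogonal d = filter (λ u → u · d ≟₃ c0)

outside : List 𝔽₈₁ → List 𝔽₈₁
outside S = filter (λ u → ¬? (u ∈? S)) directions

∑ : {A : Set} → List A → (A → ℕ) → ℕ
∑ []       f = 0
∑ (x ∷ xs) f = f x + ∑ xs f

syntax ∑ xs (λ x → e) = ∑[ x ∈ xs ] e

𝟙 : {P : Set} → Dec P → ℕ
𝟙 (yes _) = 1
𝟙 (no _)  = 0

count : {A : Set} {P : A → Set} → Decidable P → List A → ℕ
count P? xs = ∑[ x ∈ xs ] 𝟙 (P? x)

module _ {A : Set} where

  ∑-cong : ∀ (xs : List A) {f g : A → ℕ} → (∀ {x} → x ∈ xs → f x ≡ g x) → ∑ xs f ≡ ∑ xs g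
  ∑-cong []       eq = refl
  ∑-cong (x ∷ xs) eq = cong₂ _+_ (eq (here refl)) (∑-cong xs (eq ∘ there))

  ∑-distrib-+ : ∀ (xs : List A) (f g : A → ℕ) → ∑[ x ∈ xs ] (f x + g x) ≡ ∑ xs f + ∑ xs g
  ∑-distrib-+ []       f g = refl
  ∑-distrib-+ (x ∷ xs) f g =
    trans (cong (f x + g x +_) (∑-distrib-+ xs f g)) (interchange (f x) (g x) (∑ xs f) (∑ xs g))

  ∑-*ˡ : ∀ (xs : List A) c (f : A → ℕ) → ∑[ x ∈ xs ] (c * f x) ≡ c * ∑ xs f
  ∑-*ˡ []       c f = sym (*-zeroʳ c)
  ∑-*ˡ (x ∷ xs) c f = trans (cong (c * f x +_) (∑-*ˡ xs c f)) (sym (*-distribˡ-+ c (f x) (∑ xs f)))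

  ∑-*ʳ : ∀ (xs : List A) c (f : A → ℕ) → ∑[ x ∈ xs ] (f x * c) ≡ ∑ xs f * c
  ∑-*ʳ xs c f = begin
    ∑[ x ∈ xs ] (f x * c) ≡⟨ ∑-cong xs (λ {x} _ → *-comm (f x) c) ⟩
    ∑[ x ∈ xs ] (c * f x) ≡⟨ ∑-*ˡ xs c f ⟩
    c * ∑ xs f            ≡⟨ *-comm c (∑ xs f) ⟩
    ∑ xs f * c            ∎
    where open ≡-Reasoning

  ∑-const : ∀ (xs : List A) c → ∑[ x ∈ xs ] c ≡ length xs * c
  ∑-const []       c = refl
  ∑-const (x ∷ xs) c = cong (c +_) (∑-const xs c)

  ∑-mono-≤ : ∀ (xs : List A) {f g : A → ℕ} → (∀ {x} → x ∈ xs → f x ≤ g x) → ∑ xs f ≤ ∑ xs g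
  ∑-mono-≤ []       le = z≤n
  ∑-mono-≤ (x ∷ xs) le = +-mono-≤ (le (here refl)) (∑-mono-≤ xs (le ∘ there))

  ∑-mono-≤-equality : ∀ (xs : List A) {f g : A → ℕ} → (∀ {x} → x ∈ xs → f x ≤ g x) →
                      ∑ xs f ≡ ∑ xs g → ∀ {x} → x ∈ xs → f x ≡ g x
  ∑-mono-≤-equality (x ∷ xs) {f} {g} le eq (here refl) = ≤-antisym (le (here refl)) gx≤fx
    where
    gx≤fx : g x ≤ f x
    gx≤fx = +-cancelʳ-≤ (∑ xs f) (g x) (f x)
      (≤-trans (+-monoʳ-≤ (g x) (∑-mono-≤ xs (le ∘ there))) (≤-reflexive (sym eq)))
  ∑-mono-≤-equality (x ∷ xs) {f} {g} le eq (there x∈xs) =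
    ∑-mono-≤-equality xs (le ∘ there) tail-eq x∈xs
    where
    tail-eq : ∑ xs f ≡ ∑ xs g
    tail-eq = +-cancelˡ-≡ (f x) (∑ xs f) (∑ xs g)
      (trans eq (cong (_+ ∑ xs g) (sym (∑-mono-≤-equality (x ∷ xs) le eq (here refl)))))

module _ {A B : Set} where

  ∑-comm : ∀ (xs : List A) (ys : List B) (f : A → B → ℕ) →
           ∑[ x ∈ xs ] ∑[ y ∈ ys ] f x y ≡ ∑[ y ∈ ys ] ∑[ x ∈ xs ] f x y
  ∑-comm []       ys f = sym (trans (∑-const ys 0) (*-zeroʳ (length ys)))
  ∑-comm (x ∷ xs) ys f =
    trans (cong (∑[ y ∈ ys ] f x y +_) (∑-comm xs ys f))
          (sym (∑-distrib-+ ys (f x) (λ y → ∑[ x ∈ xs ] f x y)))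

module _ {P : Set} where

  𝟙-yes : (p? : Dec P) → P → 𝟙 p? ≡ 1
  𝟙-yes (yes _) _ = refl
  𝟙-yes (no ¬p) p = ⊥-elim (¬p p)

  𝟙-no : (p? : Dec P) → ¬ P → 𝟙 p? ≡ 0
  𝟙-no (yes p) ¬p = ⊥-elim (¬p p)
  𝟙-no (no _)  _  = refl

module _ {P Q : Set} where

  𝟙-⇔ : P ⇔ Q → (p? : Dec P) (q? : Dec Q) → 𝟙 p? ≡ 𝟙 q?
  𝟙-⇔ P⇔Q (yes p) q? = sym (𝟙-yes q? (to P⇔Q p))
  𝟙-⇔ P⇔Q (no ¬p) q? = sym (𝟙-no q? (¬p ∘ from P⇔Q))

  𝟙-× : (p? : Dec P) (q? : Dec Q) → 𝟙 (p? ×-dec q?) ≡ 𝟙 p? * 𝟙 q?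
  𝟙-× (yes _) (yes _) = refl
  𝟙-× (yes _) (no _)  = refl
  𝟙-× (no _)  _       = refl

module _ {A : Set} {P Q : A → Set} where

  count-⇔ : (∀ x → P x ⇔ Q x) → (P? : Decidable P) (Q? : Decidable Q) → ∀ xs → count P? xs ≡ count Q? xs
  count-⇔ P⇔Q P? Q? xs = ∑-cong xs λ {x} _ → 𝟙-⇔ (P⇔Q x) (P? x) (Q? x)

  count-×-dec : (P? : Decidable P) (Q? : Decidable Q) → ∀ xs →
                count (λ x → P? x ×-dec Q? x) xs ≡ count Q? (filter P? xs)
  count-×-dec P? Q? []       = refl
  count-×-dec P? Q? (x ∷ xs) with P? x
  ... | yes p =
    cong₂ _+_ (trans (𝟙-× (yes p) (Q? x)) (+-identityʳ (𝟙 (Q? x)))) (count-×-dec P? Q? xs)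
  ... | no ¬p = count-×-dec P? Q? xs

count≡length-filter : {A : Set} {P : A → Set} (P? : Decidable P) → ∀ xs → count P? xs ≡ length (filter P? xs)
count≡length-filter P? []       = refl
count≡length-filter P? (x ∷ xs) with P? x
... | yes p = cong suc (count≡length-filter P? xs)
... | no ¬p = count≡length-filter P? xs

module _ {A : Set} (_≟_ : DecidableEquality A) where

  ∑-𝟙-≟ : ∀ {xs x} → Unique xs → x ∈ xs → ∑[ y ∈ xs ] 𝟙 (y ≟ x) ≡ 1
  ∑-𝟙-≟ {y ∷ ys} (y∉ys ∷ _) (here refl) =
    cong₂ _+_ (𝟙-yes (y ≟ y) refl)
              (trans (∑-cong ys λ z∈ys → 𝟙-no (_ ≟ y) (lookup y∉ys z∈ys ∘ sym))
                     (trans (∑-const ys 0) (*-zeroʳ (length ys))))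
  ∑-𝟙-≟ {y ∷ ys} (y∉ys ∷ u) (there x∈ys) =
    cong₂ _+_ (𝟙-no (y ≟ _) (lookup y∉ys x∈ys)) (∑-𝟙-≟ u x∈ys)

  ∑-point-mass : ∀ {xs x} a b → Unique xs → x ∈ xs → ∑[ y ∈ xs ] (a + b * 𝟙 (y ≟ x)) ≡ length xs * a + b
  ∑-point-mass {xs} {x} a b u x∈xs = begin
    ∑[ y ∈ xs ] (a + b * 𝟙 (y ≟ x))       ≡⟨ ∑-distrib-+ xs (λ _ → a) (λ y → b * 𝟙 (y ≟ x)) ⟩
    ∑[ y ∈ xs ] a + ∑[ y ∈ xs ] (b * 𝟙 (y ≟ x)) ≡⟨ cong₂ _+_ (∑-const xs a) (∑-*ˡ xs b (λ y → 𝟙 (y ≟ x))) ⟩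
    length xs * a + b * ∑[ y ∈ xs ] 𝟙 (y ≟ x)   ≡⟨ cong (λ t → length xs * a + b * t) (∑-𝟙-≟ u x∈xs) ⟩
    length xs * a + b * 1                       ≡⟨ cong (length xs * a +_) (*-identityʳ b) ⟩
    length xs * a + b                           ∎
    where open ≡-Reasoning

  ∑-diagonal : ∀ {xs x} {f : A → ℕ} a b → Unique xs → x ∈ xs →
               (∀ {y} → y ∈ xs → y ≢ x → f y ≡ a) → f x ≡ a + b → ∑ xs f ≡ length xs * a + b
  ∑-diagonal {xs} {x} {f} a b u x∈xs off on =
    trans (∑-cong xs pointwise) (∑-point-mass a b u x∈xs)
    where
    pointwise : ∀ {y} → y ∈ xs → f y ≡ a + b * 𝟙 (y ≟ x)
    pointwise {y} y∈xs with y ≟ x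
    ... | yes refl = trans on (cong (a +_) (sym (*-identityʳ b)))
    ... | no y≢x   = trans (off y∈xs y≢x) (sym (trans (cong (a +_) (*-zeroʳ b)) (+-identityʳ a)))

  ∑-two-point-masses : ∀ {xs x y} a b → Unique xs → x ∈ xs → y ∈ xs →
    ∑[ z ∈ xs ] (a + b * 𝟙 (z ≟ x) + b * 𝟙 (z ≟ y)) ≡ length xs * a + b + b
  ∑-two-point-masses {xs} {x} {y} a b u x∈xs y∈xs = begin
    ∑[ z ∈ xs ] (a + b * 𝟙 (z ≟ x) + b * 𝟙 (z ≟ y))
      ≡⟨ ∑-distrib-+ xs (λ z → a + b * 𝟙 (z ≟ x)) (λ z → b * 𝟙 (z ≟ y)) ⟩
    ∑[ z ∈ xs ] (a + b * 𝟙 (z ≟ x)) + ∑[ z ∈ xs ] (b * 𝟙 (z ≟ y))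
      ≡⟨ cong₂ _+_ (∑-point-mass a b u x∈xs) (∑-*ˡ xs b (λ z → 𝟙 (z ≟ y))) ⟩
    length xs * a + b + b * ∑[ z ∈ xs ] 𝟙 (z ≟ y)
      ≡⟨ cong (λ t → length xs * a + b + b * t) (∑-𝟙-≟ u y∈xs) ⟩
    length xs * a + b + b * 1
      ≡⟨ cong (length xs * a + b +_) (*-identityʳ b) ⟩
    length xs * a + b + b ∎
    where open ≡-Reasoning

∑-affine : ∀ {A : Set} (xs : List A) {f t : A → ℕ} a b → (∀ {x} → x ∈ xs → f x ≡ a + t x * b) →
           ∑ xs f ≡ length xs * a + ∑ xs t * b
∑-affine xs {f} {t} a b eq = begin
  ∑ xs f                                 ≡⟨ ∑-cong xs eq ⟩
  ∑[ x ∈ xs ] (a + t x * b)              ≡⟨ ∑-distrib-+ xs (λ _ → a) (λ x → t x * b) ⟩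
  ∑[ x ∈ xs ] a + ∑[ x ∈ xs ] (t x * b)  ≡⟨ cong₂ _+_ (∑-const xs a) (∑-*ʳ xs b t) ⟩
  length xs * a + ∑ xs t * b             ∎
  where open ≡-Reasoning

-- Sections of a list of points along a direction, and their moments

∑₃ : (𝔽₃ → ℕ) → ℕ
∑₃ h = h c0 + h c1 + h c2

∑₃-cong : ∀ {h h′ : 𝔽₃ → ℕ} → (∀ v → h v ≡ h′ v) → ∑₃ h ≡ ∑₃ h′
∑₃-cong eq = cong₂ _+_ (cong₂ _+_ (eq c0) (eq c1)) (eq c2)

∑-∑₃ : ∀ {A : Set} (xs : List A) (h : A → 𝔽₃ → ℕ) → ∑[ x ∈ xs ] ∑₃ (h x) ≡ ∑₃ (λ v → ∑[ x ∈ xs ] h x v)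
∑-∑₃ xs h = begin
  ∑[ x ∈ xs ] (h x c0 + h x c1 + h x c2)
    ≡⟨ ∑-distrib-+ xs (λ x → h x c0 + h x c1) (λ x → h x c2) ⟩
  ∑[ x ∈ xs ] (h x c0 + h x c1) + ∑[ x ∈ xs ] h x c2
    ≡⟨ cong (_+ ∑[ x ∈ xs ] h x c2) (∑-distrib-+ xs (λ x → h x c0) (λ x → h x c1)) ⟩
  ∑₃ (λ v → ∑[ x ∈ xs ] h x v) ∎
  where open ≡-Reasoning

𝟙-expansion : ∀ (g : 𝔽₃ → ℕ) a → g a ≡ ∑₃ (λ v → 𝟙 (a ≟₃ v) * g v)
𝟙-expansion g c0 rewrite +-identityʳ (g c0) | +-identityʳ (g c0) | +-identityʳ (g c0) = refl
𝟙-expansion g c1 rewrite +-identityʳ (g c1) | +-identityʳ (g c1) = refl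
𝟙-expansion g c2 rewrite +-identityʳ (g c2) = refl

∑-fibres : ∀ {A : Set} (f : A → 𝔽₃) (g : 𝔽₃ → ℕ) (xs : List A) →
           ∑[ x ∈ xs ] g (f x) ≡ ∑₃ (λ v → count (λ x → f x ≟₃ v) xs * g v)
∑-fibres f g xs = begin
  ∑[ x ∈ xs ] g (f x)                              ≡⟨ ∑-cong xs (λ {x} _ → 𝟙-expansion g (f x)) ⟩
  ∑[ x ∈ xs ] ∑₃ (λ v → 𝟙 (f x ≟₃ v) * g v)        ≡⟨ ∑-∑₃ xs (λ x v → 𝟙 (f x ≟₃ v) * g v) ⟩
  ∑₃ (λ v → ∑[ x ∈ xs ] (𝟙 (f x ≟₃ v) * g v))      ≡⟨ ∑₃-cong (λ v → ∑-*ʳ xs (g v) (λ x → 𝟙 (f x ≟₃ v))) ⟩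
  ∑₃ (λ v → count (λ x → f x ≟₃ v) xs * g v)       ∎
  where open ≡-Reasoning

section : 𝔽₈₁ → 𝔽₃ → List 𝔽₈₁ → List 𝔽₈₁
section u v = filter (λ x → u · x ≟₃ v)

sectionSize : 𝔽₈₁ → List 𝔽₈₁ → 𝔽₃ → ℕ
sectionSize u L v = count (λ x → u · x ≟₃ v) L

sectionSize≡length-section : ∀ u L v → sectionSize u L v ≡ length (section u v L)
sectionSize≡length-section u L v = count≡length-filter (λ x → u · x ≟₃ v) L

∑₃-sectionSize : ∀ u L → ∑₃ (sectionSize u L) ≡ length L
∑₃-sectionSize u L = begin
  ∑₃ (sectionSize u L)                   ≡⟨ ∑₃-cong (λ v → sym (*-identityʳ (sectionSize u L v))) ⟩
  ∑₃ (λ v → sectionSize u L v * 1)       ≡⟨ sym (∑-fibres (u ·_) (λ _ → 1) L) ⟩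
  ∑[ x ∈ L ] 1                           ≡⟨ ∑-const L 1 ⟩
  length L * 1                           ≡⟨ *-identityʳ (length L) ⟩
  length L                               ∎
  where open ≡-Reasoning

secondMoment : 𝔽₈₁ → List 𝔽₈₁ → ℕ
secondMoment u L = ∑[ x ∈ L ] ∑[ y ∈ L ] 𝟙 (u · y ≟₃ u · x)

thirdMoment : 𝔽₈₁ → List 𝔽₈₁ → ℕ
thirdMoment u L = ∑[ x ∈ L ] ∑[ y ∈ L ] ∑[ z ∈ L ] (𝟙 (u · y ≟₃ u · x) * 𝟙 (u · z ≟₃ u · x))

secondMoment≡∑₃-sectionSize² : ∀ u L →
  secondMoment u L ≡ ∑₃ (λ v → sectionSize u L v * sectionSize u L v)
secondMoment≡∑₃-sectionSize² u L = ∑-fibres (u ·_) (sectionSize u L) L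

thirdMoment≡∑₃-sectionSize³ : ∀ u L →
  thirdMoment u L ≡ ∑₃ (λ v → sectionSize u L v * (sectionSize u L v * sectionSize u L v))
thirdMoment≡∑₃-sectionSize³ u L =
  trans (∑-cong L (λ {x} _ → inner x)) (∑-fibres (u ·_) (λ v → s v * s v) L)
  where
  s : 𝔽₃ → ℕ
  s = sectionSize u L
  inner : ∀ x → ∑[ y ∈ L ] ∑[ z ∈ L ] (𝟙 (u · y ≟₃ u · x) * 𝟙 (u · z ≟₃ u · x)) ≡ s (u · x) * s (u · x)
  inner x = trans (∑-cong L (λ {y} _ → ∑-*ˡ L (𝟙 (u · y ≟₃ u · x)) (λ z → 𝟙 (u · z ≟₃ u · x))))
                  (∑-*ʳ L (s (u · x)) (λ y → 𝟙 (u · y ≟₃ u · x)))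

agreements : List 𝔽₈₁ → 𝔽₈₁ → 𝔽₈₁ → ℕ
agreements U x y = count (λ u → u · y ≟₃ u · x) U

∑-secondMoment : ∀ U L → ∑[ u ∈ U ] secondMoment u L ≡ ∑[ x ∈ L ] ∑[ y ∈ L ] agreements U x y
∑-secondMoment U L =
  trans (∑-comm U L (λ u x → ∑[ y ∈ L ] 𝟙 (u · y ≟₃ u · x)))
        (∑-cong L (λ {x} _ → ∑-comm U L (λ u y → 𝟙 (u · y ≟₃ u · x))))

agreements² : List 𝔽₈₁ → 𝔽₈₁ → 𝔽₈₁ → 𝔽₈₁ → ℕ
agreements² U x y z = count (λ u → (u · y ≟₃ u · x) ×-dec (u · z ≟₃ u · x)) U

∑-thirdMoment : ∀ U L → ∑[ u ∈ U ] thirdMoment u L ≡ ∑[ x ∈ L ] ∑[ y ∈ L ] ∑[ z ∈ L ] agreements² U x y z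
∑-thirdMoment U L =
  trans (∑-comm U L (λ u x → ∑[ y ∈ L ] ∑[ z ∈ L ] 𝟙-yz u x y z))
        (∑-cong L λ {x} _ → trans (∑-comm U L (λ u y → ∑[ z ∈ L ] 𝟙-yz u x y z))
          (∑-cong L λ {y} _ → trans (∑-comm U L (λ u z → 𝟙-yz u x y z))
            (∑-cong L λ {z} _ → ∑-cong U λ {u} _ → sym (𝟙-× (u · y ≟₃ u · x) (u · z ≟₃ u · x)))))
  where
  𝟙-yz : 𝔽₈₁ → 𝔽₈₁ → 𝔽₈₁ → 𝔽₈₁ → ℕ
  𝟙-yz u x y z = 𝟙 (u · y ≟₃ u · x) * 𝟙 (u · z ≟₃ u · x)

·-agree⇔·-kills-normalise : ∀ u x y → (u · y ≡ u · x) ⇔ (u · normalise (y -F x) ≡ c0)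
·-agree⇔·-kills-normalise u x y = ⇔.trans (·-agree⇔·-kills u y x) (⇔.sym (·-kills-normalise u (y -F x)))

agreements≡length-orthogonal : ∀ U x y → agreements U x y ≡ length (orthogonal (normalise (y -F x)) U)
agreements≡length-orthogonal U x y =
  trans (count-⇔ (λ u → ·-agree⇔·-kills-normalise u x y) _ _ U)
        (count≡length-filter (λ u → u · normalise (y -F x) ≟₃ c0) U)

agreements-refl : ∀ U x → agreements U x x ≡ length U
agreements-refl U x =
  trans (∑-cong U (λ {u} _ → 𝟙-yes (u · x ≟₃ u · x) refl)) (trans (∑-const U 1) (*-identityʳ (length U)))

agreements²≡length-orthogonal² : ∀ U x y z →
  agreements² U x y z ≡ length (orthogonal (normalise (z -F x)) (orthogonal (normalise (y -F x)) U))
agreements²≡length-orthogonal² U x y z = begin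
  agreements² U x y z
    ≡⟨ count-⇔ (λ u → ·-agree⇔·-kills-normalise u x y ×-⇔ ·-agree⇔·-kills-normalise u x z) _ _ U ⟩
  count (λ u → kills dy u ×-dec kills dz u) U
    ≡⟨ count-×-dec (kills dy) (kills dz) U ⟩
  count (kills dz) (orthogonal dy U)
    ≡⟨ count≡length-filter (kills dz) (orthogonal dy U) ⟩
  length (orthogonal dz (orthogonal dy U)) ∎
  where
  open ≡-Reasoning
  dy dz : 𝔽₈₁
  dy = normalise (y -F x)
  dz = normalise (z -F x)
  kills : (d u : 𝔽₈₁) → Dec (u · d ≡ c0)
  kills d u = u · d ≟₃ c0

agreements²-at-x : ∀ U x y → agreements² U x y x ≡ agreements U x y
agreements²-at-x U x y = count-⇔ (λ u → mk⇔ proj₁ (_, refl)) _ _ U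

agreements²-at-y : ∀ U x y → agreements² U x y y ≡ agreements U x y
agreements²-at-y U x y = count-⇔ (λ u → mk⇔ proj₁ (λ p → p , p)) _ _ U

agreements²-diagonal : ∀ U x z → agreements² U x x z ≡ agreements U x z
agreements²-diagonal U x z = count-⇔ (λ u → mk⇔ proj₂ (refl ,_)) _ _ U

∑-secondMoment-exact : ∀ U {L A B} → Unique L → length U ≡ A + B →
  (∀ {x y} → x ∈ L → y ∈ L → y ≢ x → agreements U x y ≡ A) →
  ∑[ u ∈ U ] secondMoment u L ≡ length L * (length L * A + B)
∑-secondMoment-exact U {L} {A} {B} uniq |U| agree = begin
  ∑[ u ∈ U ] secondMoment u L                 ≡⟨ ∑-secondMoment U L ⟩
  ∑[ x ∈ L ] ∑[ y ∈ L ] agreements U x y      ≡⟨ ∑-cong L row ⟩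
  ∑[ x ∈ L ] (length L * A + B)               ≡⟨ ∑-const L (length L * A + B) ⟩
  length L * (length L * A + B)               ∎
  where
  open ≡-Reasoning
  row : ∀ {x} → x ∈ L → ∑[ y ∈ L ] agreements U x y ≡ length L * A + B
  row {x} x∈L = ∑-diagonal _≟F_ A B uniq x∈L (agree x∈L) (trans (agreements-refl U x) |U|)

SquareBound : ℕ → ℕ → ℕ → Set
SquareBound m n Q = ∀ (s : 𝔽₃ → ℕ) → (∀ v → s v < m) → ∑₃ s ≡ n → ∑₃ (λ v → s v * s v) ≤ Q

secondMoment≤ : ∀ {u L m Q} → (∀ v → sectionSize u L v < m) → SquareBound m (length L) Q → secondMoment u L ≤ Q
secondMoment≤ {u} {L} small bound =
  subst (_≤ _) (sym (secondMoment≡∑₃-sectionSize² u L)) (bound (sectionSize u L) small (∑₃-sectionSize u L))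

second-moment-bound : ∀ U {L A B m Q} → Unique L → length U ≡ A + B →
  (∀ {x y} → x ∈ L → y ∈ L → y ≢ x → agreements U x y ≡ A) →
  (∀ {u} → u ∈ U → ∀ v → sectionSize u L v < m) → SquareBound m (length L) Q →
  length L * (length L * A + B) ≤ length U * Q
second-moment-bound U {L} {A} {B} {m} {Q} uniq |U| agree small bound = begin
  length L * (length L * A + B)  ≡⟨ sym (∑-secondMoment-exact U uniq |U| agree) ⟩
  ∑[ u ∈ U ] secondMoment u L    ≤⟨ ∑-mono-≤ U (λ {u} u∈U → secondMoment≤ {u} {L} (small u∈U) bound) ⟩
  ∑[ u ∈ U ] Q                   ≡⟨ ∑-const U Q ⟩
  length U * Q                   ∎
  where open ≤-Reasoning

IsProjLine : List 𝔽₈₁ → Set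
IsProjLine K = length K ≡ 4 × All (λ u₀ → All (λ u₁ → u₀ ≢ u₁ → All (_∈ projLine u₀ u₁) K) K) K

-- In PG(3,3), orthogonal d directions is the plane d⊥ (13 points) and the intersection of two planes
-- is a line (4 points). The decisions are opaque so that the type checker never re-runs them.
opaque
  length-orthogonal≡13 : All (λ d → length (orthogonal d directions) ≡ 13) directions
  length-orthogonal≡13 = from-yes (all? (λ d → length (orthogonal d directions) ≟ 13) directions)

  length-outside-point≡39 : All (λ u₀ → length (outside (u₀ ∷ [])) ≡ 39) directions
  length-outside-point≡39 = from-yes (all? (λ u₀ → length (outside (u₀ ∷ [])) ≟ 39) directions)

  length-orthogonal-outside-point≡12 :
    All (λ d → All (λ u₀ → length (orthogonal d (outside (u₀ ∷ []))) ≡ 12) (orthogonal d directions)) directions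
  length-orthogonal-outside-point≡12 = from-yes (all? (λ d → all? (λ u₀ →
    length (orthogonal d (outside (u₀ ∷ []))) ≟ 12) (orthogonal d directions)) directions)

  length-outside-line≡36 :
    All (λ u₀ → All (λ u₁ → u₀ ≢ u₁ → length (outside (projLine u₀ u₁)) ≡ 36) directions) directions
  length-outside-line≡36 = from-yes (all? (λ u₀ → all? (λ u₁ →
    ¬? (u₀ ≟F u₁) →-dec (length (outside (projLine u₀ u₁)) ≟ 36)) directions) directions)

  length-orthogonal-outside-line≡9 :
    All (λ d → All (λ u₀ → All (λ u₁ → u₀ ≢ u₁ → length (orthogonal d (outside (projLine u₀ u₁))) ≡ 9)
                               (orthogonal d directions)) (orthogonal d directions)) directions
  length-orthogonal-outside-line≡9 = from-yes (all? (λ d → all? (λ u₀ → all? (λ u₁ →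
    ¬? (u₀ ≟F u₁) →-dec (length (orthogonal d (outside (projLine u₀ u₁))) ≟ 9))
      (orthogonal d directions)) (orthogonal d directions)) directions)

  orthogonal²-isProjLine :
    All (λ a → All (λ b → a ≢ b → IsProjLine (orthogonal b (orthogonal a directions))) directions) directions
  orthogonal²-isProjLine = from-yes (all? (λ a → all? (λ b →
    ¬? (a ≟F b) →-dec isProjLine? (orthogonal b (orthogonal a directions))) directions) directions)
    where
    isProjLine? : (K : List 𝔽₈₁) → Dec (IsProjLine K)
    isProjLine? K = (length K ≟ 4) ×-dec
      all? (λ u₀ → all? (λ u₁ → ¬? (u₀ ≟F u₁) →-dec all? (_∈? projLine u₀ u₁) K) K) K

-- Caps in affine subspaces

cap-mono : ∀ {S T : Subset} → (∀ {x} → S x → T x) → IsCapSet T → IsCapSet S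
cap-mono S⊆T capT a b c a∈S b∈S c∈S = capT a b c (S⊆T a∈S) (S⊆T b∈S) (S⊆T c∈S)

cap-differences-independent : ∀ {S x y z} → IsCapSet S → S x → S y → S z →
  x ≢ y → y ≢ z → x ≢ z → normalise (y -F x) ≢ normalise (z -F x)
cap-differences-independent {x = x} {y} {z} cap x∈S y∈S z∈S x≢y y≢z x≢z eq
  with normalise-injective± (z -F x) (y -F x) (sym eq)
... | inj₁ same     = y≢z (sym (-F-cancelʳ z y x same))
... | inj₂ opposite = cap x y z x∈S y∈S z∈S x≢y y≢z x≢z (midpointF⇒sum≡0 x y z opposite)

difference∈directions : ∀ {x y} → y ≢ x → normalise (y -F x) ∈ directions
difference∈directions {x} {y} y≢x = normalise∈directions (y≢x ∘ x-Fy≡0⇒x≡y y x)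

∈-orthogonal : ∀ {u U x y v} → u ∈ U → u · x ≡ v → u · y ≡ v → u ∈ orthogonal (normalise (y -F x)) U
∈-orthogonal {u} {U} {x} {y} u∈U ux≡v uy≡v =
  ∈-filter⁺ (λ u → u · normalise (y -F x) ≟₃ c0) u∈U
            (to (·-agree⇔·-kills-normalise u x y) (trans uy≡v (sym ux≡v)))

-- An affine subspace, given as the intersection of the hyperplanes u · x = v.
Flat : Set
Flat = List (𝔽₈₁ × 𝔽₃)

_∈ᶠ_ : 𝔽₈₁ → Flat → Set
x ∈ᶠ F = All (λ (u , v) → u · x ≡ v) F

CapIn : Flat → List 𝔽₈₁ → Set
CapIn F L = IsCapSet (_∈ L) × All (_∈ᶠ F) L

CapBound : Flat → ℕ → Set
CapBound F k = ∀ {L} → Unique L → CapIn F L → length L < k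

CapIn-⊆ : ∀ {F xs ys} → xs ⊆ ys → CapIn F ys → CapIn F xs
CapIn-⊆ xs⊆ys (cap , inF) = cap-mono xs⊆ys cap , anti-mono xs⊆ys inF

CapIn-section : ∀ {F L} u v → CapIn F L → CapIn ((u , v) ∷ F) (section u v L)
CapIn-section {F} {L} u v (cap , inF) =
  cap-mono (filter-⊆ on? L) cap , zipWith (λ (onH , x∈F) → onH ∷ x∈F) (all-filter on? L , filter⁺ on? inF)
  where
  on? : (x : 𝔽₈₁) → Dec (u · x ≡ v)
  on? x = u · x ≟₃ v

sectionSize< : ∀ {F L u k} → Unique L → CapIn F L → (∀ v → CapBound ((u , v) ∷ F) k) → ∀ v → sectionSize u L v < k
sectionSize< {L = L} {u} uniq capIn bound v =
  subst (_< _) (sym (sectionSize≡length-section u L v))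
        (bound v (Unique.filter⁺ (λ x → u · x ≟₃ v) uniq) (CapIn-section u v capIn))

-- Truncating to the first k elements reduces a bound to the case of exactly k elements.
length<-of-no-size : ∀ {A : Set} {P : List A → Set} k → (∀ {xs ys} → xs ⊆ ys → P ys → P xs) →
  (∀ {xs} → Unique xs → P xs → length xs ≢ k) → ∀ {xs} → Unique xs → P xs → length xs < k
length<-of-no-size k mono none {xs} uniq p with length xs <? k
... | yes lt = lt
... | no ¬lt = ⊥-elim (none (Unique.take⁺ k uniq) (mono (Any-resp-⊆ (take-⊆ k xs)) p)
                              (trans (length-take k xs) (m≤n⇒m⊓n≡m (≮⇒≥ ¬lt))))

squareBound : ∀ m n Q →
  {True (allUpTo? (λ a → allUpTo? (λ b → allUpTo? (λ c → (a + b + c ≟ n) →-dec (a * a + b * b + c * c ≤? Q)) m) m) m)} →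
  SquareBound m n Q
squareBound m n Q {ok} s s<m ∑s≡n = toWitness ok (s<m c0) (s<m c1) (s<m c2) ∑s≡n

second-moment-cap-bound : ∀ {F} U k {A B m Q} → length U ≡ A + B → (A + B) * Q < k * (k * A + B) →
  SquareBound m k Q → (∀ {x y} → x ∈ᶠ F → y ∈ᶠ F → y ≢ x → agreements U x y ≡ A) →
  (∀ {u} → u ∈ U → ∀ v → CapBound ((u , v) ∷ F) m) → CapBound F k
second-moment-cap-bound {F} U k {A} {B} {m} {Q} |U| gap square agree sections =
  length<-of-no-size k CapIn-⊆ no-k
  where
  no-k : ∀ {L} → Unique L → CapIn F L → length L ≢ k
  no-k {L} uniq capIn@(_ , inF) |L|≡k = <⇒≱ gap (subst₂ (λ n N → n * (n * A + B) ≤ N * Q) |L|≡k |U| bound)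
    where
    bound : length L * (length L * A + B) ≤ length U * Q
    bound = second-moment-bound U uniq |U| (λ x∈L y∈L → agree (lookup inF x∈L) (lookup inF y∈L))
              (λ u∈U → sectionSize< uniq capIn (sections u∈U)) (subst (λ n → SquareBound m n Q) (sym |L|≡k) square)

-- Three cap points x, y, z would put all three normals on the projective line (y - x)⊥ ∩ (z - x)⊥,
-- which is spanned by any two of its points.
line-cap-bound : ∀ {u₀ u₁ u₂ v₀ v₁ v₂} → u₀ ∈ directions → u₁ ∈ directions → u₂ ∈ directions →
  u₀ ≢ u₁ → u₂ ∉ projLine u₀ u₁ → CapBound ((u₂ , v₂) ∷ (u₀ , v₀) ∷ (u₁ , v₁) ∷ []) 3
line-cap-bound {u₀} {u₁} {u₂} {v₀} {v₁} {v₂} u₀∈ u₁∈ u₂∈ u₀≢u₁ u₂∉line = length<-of-no-size 3 CapIn-⊆ no-three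
  where
  no-three : ∀ {L} → Unique L → CapIn ((u₂ , v₂) ∷ (u₀ , v₀) ∷ (u₁ , v₁) ∷ []) L → length L ≢ 3
  no-three {x ∷ y ∷ z ∷ []} ((x≢y ∷ x≢z ∷ []) ∷ (y≢z ∷ []) ∷ [] ∷ [])
           (cap , (x₂ ∷ x₀ ∷ x₁ ∷ []) ∷ (y₂ ∷ y₀ ∷ y₁ ∷ []) ∷ (z₂ ∷ z₀ ∷ z₁ ∷ []) ∷ []) refl =
    u₂∉line (lookup (lookup (lookup spans (∈K u₀∈ x₀ y₀ z₀)) (∈K u₁∈ x₁ y₁ z₁) u₀≢u₁) (∈K u₂∈ x₂ y₂ z₂))
    where
    K : List 𝔽₈₁
    K = orthogonal (normalise (z -F x)) (orthogonal (normalise (y -F x)) directions)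
    independent : normalise (y -F x) ≢ normalise (z -F x)
    independent = cap-differences-independent cap (here refl) (there (here refl)) (there (there (here refl)))
                    x≢y y≢z x≢z
    spans : All (λ u₀ → All (λ u₁ → u₀ ≢ u₁ → All (_∈ projLine u₀ u₁) K) K) K
    spans = proj₂ (lookup (lookup orthogonal²-isProjLine (difference∈directions (x≢y ∘ sym)))
                          (difference∈directions (x≢z ∘ sym)) independent)
    ∈K : ∀ {u v} → u ∈ directions → u · x ≡ v → u · y ≡ v → u · z ≡ v → u ∈ K
    ∈K u∈ ux uy uz = ∈-orthogonal (∈-orthogonal u∈ ux uy) ux uz

plane-cap-bound : ∀ {u₀ u₁ v₀ v₁} → u₀ ∈ directions → u₁ ∈ directions → u₀ ≢ u₁ →
  CapBound ((u₀ , v₀) ∷ (u₁ , v₁) ∷ []) 5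
plane-cap-bound {u₀} {u₁} {v₀} {v₁} u₀∈ u₁∈ u₀≢u₁ =
  second-moment-cap-bound U 5 (lookup (lookup length-outside-line≡36 u₀∈) u₁∈ u₀≢u₁) (from-yes (324 <? 360))
    (squareBound 3 5 9) agree sections
  where
  U : List 𝔽₈₁
  U = outside (projLine u₀ u₁)
  F : Flat
  F = (u₀ , v₀) ∷ (u₁ , v₁) ∷ []
  agree : ∀ {x y} → x ∈ᶠ F → y ∈ᶠ F → y ≢ x → agreements U x y ≡ 9
  agree {x} {y} (x₀ ∷ x₁ ∷ []) (y₀ ∷ y₁ ∷ []) y≢x =
    trans (agreements≡length-orthogonal U x y)
          (lookup (lookup (lookup length-orthogonal-outside-line≡9 (difference∈directions y≢x))
            (∈-orthogonal u₀∈ x₀ y₀)) (∈-orthogonal u₁∈ x₁ y₁) u₀≢u₁)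
  sections : ∀ {u} → u ∈ U → ∀ v → CapBound ((u , v) ∷ F) 3
  sections u∈U v with ∈-filter⁻ (λ u → ¬? (u ∈? projLine u₀ u₁)) u∈U
  ... | u∈ , u∉line = line-cap-bound u₀∈ u₁∈ u∈ u₀≢u₁ u∉line

solid-cap-bound : ∀ {u₀ v₀} → u₀ ∈ directions → CapBound ((u₀ , v₀) ∷ []) 10
solid-cap-bound {u₀} {v₀} u₀∈ =
  second-moment-cap-bound U 10 (lookup length-outside-point≡39 u₀∈) (from-yes (1404 <? 1470))
    (squareBound 5 10 36) agree sections
  where
  U : List 𝔽₈₁
  U = outside (u₀ ∷ [])
  F : Flat
  F = (u₀ , v₀) ∷ []
  agree : ∀ {x y} → x ∈ᶠ F → y ∈ᶠ F → y ≢ x → agreements U x y ≡ 12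
  agree {x} {y} (x₀ ∷ []) (y₀ ∷ []) y≢x =
    trans (agreements≡length-orthogonal U x y)
          (lookup (lookup length-orthogonal-outside-point≡12 (difference∈directions y≢x)) (∈-orthogonal u₀∈ x₀ y₀))
  sections : ∀ {u} → u ∈ U → ∀ v → CapBound ((u , v) ∷ F) 5
  sections u∈U v with ∈-filter⁻ (λ u → ¬? (u ∈? (u₀ ∷ []))) u∈U
  ... | u∈ , u∉u₀ = plane-cap-bound u∈ u₀∈ (u∉u₀ ∘ here)

agreements-directions : ∀ {x y} → y ≢ x → agreements directions x y ≡ 13
agreements-directions {x} {y} y≢x =
  trans (agreements≡length-orthogonal directions x y) (lookup length-orthogonal≡13 (difference∈directions y≢x))

∑-thirdMoment-exact : ∀ {L} → Unique L → IsCapSet (_∈ L) → let n = length L in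
  ∑[ u ∈ directions ] thirdMoment u L ≡ n * (n * (n * 4 + 18) + (9 * n + 9))
∑-thirdMoment-exact {L} uniq cap = begin
  ∑[ u ∈ directions ] thirdMoment u L                               ≡⟨ ∑-thirdMoment directions L ⟩
  ∑[ x ∈ L ] ∑[ y ∈ L ] ∑[ z ∈ L ] agreements² directions x y z     ≡⟨ ∑-cong L row ⟩
  ∑[ x ∈ L ] (n * (n * 4 + 18) + (9 * n + 9))                        ≡⟨ ∑-const L _ ⟩
  n * (n * (n * 4 + 18) + (9 * n + 9))                               ∎
  where
  open ≡-Reasoning
  n : ℕ
  n = length L
  triple : ∀ {x y z} → x ∈ L → y ∈ L → z ∈ L → y ≢ x →
           agreements² directions x y z ≡ 4 + 9 * 𝟙 (z ≟F x) + 9 * 𝟙 (z ≟F y)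
  triple {x} {y} {z} x∈L y∈L z∈L y≢x with z ≟F x
  ... | yes refl = trans (agreements²-at-x directions x y)
                     (trans (agreements-directions y≢x) (cong (λ t → 13 + 9 * t) (sym (𝟙-no (x ≟F y) (y≢x ∘ sym)))))
  ... | no z≢x with z ≟F y
  ...   | yes refl = trans (agreements²-at-y directions x y) (agreements-directions y≢x)
  ...   | no z≢y   = trans (agreements²≡length-orthogonal² directions x y z)
    (proj₁ (lookup (lookup orthogonal²-isProjLine (difference∈directions y≢x)) (difference∈directions z≢x)
      (cap-differences-independent cap x∈L y∈L z∈L (y≢x ∘ sym) (z≢y ∘ sym) (z≢x ∘ sym))))
  diagonal-identity : ∀ n → n * 13 + 27 ≡ n * 4 + 18 + (9 * n + 9)
  diagonal-identity = solve-∀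
  row : ∀ {x} → x ∈ L → ∑[ y ∈ L ] ∑[ z ∈ L ] agreements² directions x y z ≡ n * (n * 4 + 18) + (9 * n + 9)
  row {x} x∈L = ∑-diagonal _≟F_ (n * 4 + 18) (9 * n + 9) uniq x∈L off on
    where
    off : ∀ {y} → y ∈ L → y ≢ x → ∑[ z ∈ L ] agreements² directions x y z ≡ n * 4 + 18
    off y∈L y≢x = trans (∑-cong L (λ z∈L → triple x∈L y∈L z∈L y≢x))
                        (trans (∑-two-point-masses _≟F_ 4 9 uniq x∈L y∈L) (+-assoc (n * 4) 9 9))
    on : ∑[ z ∈ L ] agreements² directions x x z ≡ n * 4 + 18 + (9 * n + 9)
    on = trans (∑-cong L (λ {z} _ → agreements²-diagonal directions x z))
               (trans (∑-diagonal _≟F_ 13 27 uniq x∈L (λ _ → agreements-directions) (agreements-refl directions x))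
                      (diagonal-identity n))

CubicBound : ℕ → ℕ → Set
CubicBound q c = (q * 19 ≤ c + 1764) × (q * 19 ≡ c + 1764 → q ≡ 147 ⊎ q ≡ 171)

-- With a + b + c = 21 the inequality is ∑ (a - 7)² (a - 5) ≥ 0; the cases of equality are the
-- profiles (7,7,7) and (3,9,9) up to order.
opaque
  cubic-bound-21 : ∀ {a} → a < 10 → ∀ {b} → b < 10 → ∀ {c} → c < 10 → a + b + c ≡ 21 →
    CubicBound (a * a + b * b + c * c) (a * (a * a) + b * (b * b) + c * (c * c))
  cubic-bound-21 = from-yes (allUpTo? (λ a → allUpTo? (λ b → allUpTo? (λ c →
    (a + b + c ≟ 21) →-dec cubicBound? (a * a + b * b + c * c) (a * (a * a) + b * (b * b) + c * (c * c))) 10) 10) 10)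
    where
    cubicBound? : ∀ q c → Dec (CubicBound q c)
    cubicBound? q c = (q * 19 ≤? c + 1764) ×-dec ((q * 19 ≟ c + 1764) →-dec (q ≟ 147 ⊎-dec q ≟ 171))

cubic-bound-sections : ∀ {L u} → Unique L → CapIn [] L → length L ≡ 21 → u ∈ directions →
  CubicBound (secondMoment u L) (thirdMoment u L)
cubic-bound-sections {L} {u} uniq capIn |L|≡21 u∈ =
  subst₂ CubicBound (sym (secondMoment≡∑₃-sectionSize² u L)) (sym (thirdMoment≡∑₃-sectionSize³ u L))
    (cubic-bound-21 (small c0) (small c1) (small c2) (trans (∑₃-sectionSize u L) |L|≡21))
  where
  small : ∀ v → sectionSize u L v < 10
  small = sectionSize< uniq capIn (λ _ → solid-cap-bound u∈)

∑-secondMoment-21 : ∀ {L} → Unique L → length L ≡ 21 → ∑[ u ∈ directions ] secondMoment u L ≡ 6300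
∑-secondMoment-21 uniq |L|≡21 =
  trans (∑-secondMoment-exact directions {A = 13} {B = 27} uniq refl (λ _ _ → agreements-directions))
        (cong (λ n → n * (n * 13 + 27)) |L|≡21)

∑-thirdMoment-21 : ∀ {L} → Unique L → IsCapSet (_∈ L) → length L ≡ 21 → ∑[ u ∈ directions ] thirdMoment u L ≡ 49140
∑-thirdMoment-21 uniq cap |L|≡21 =
  trans (∑-thirdMoment-exact uniq cap) (cong (λ n → n * (n * (n * 4 + 18) + (9 * n + 9))) |L|≡21)

∑-sides-equal : ∀ {L} → Unique L → IsCapSet (_∈ L) → length L ≡ 21 →
  ∑[ u ∈ directions ] (secondMoment u L * 19) ≡ ∑[ u ∈ directions ] (thirdMoment u L + 1764)
∑-sides-equal {L} uniq cap |L|≡21 = begin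
    ∑[ u ∈ directions ] (secondMoment u L * 19)     ≡⟨ ∑-*ʳ directions 19 (λ u → secondMoment u L) ⟩
    ∑[ u ∈ directions ] secondMoment u L * 19       ≡⟨ cong (_* 19) (∑-secondMoment-21 uniq |L|≡21) ⟩
    6300 * 19                                        ≡⟨ cong (_+ 40 * 1764) (sym (∑-thirdMoment-21 uniq cap |L|≡21)) ⟩
    ∑[ u ∈ directions ] thirdMoment u L + 40 * 1764  ≡⟨ sym (∑-distrib-+ directions (λ u → thirdMoment u L) (λ _ → 1764)) ⟩
    ∑[ u ∈ directions ] (thirdMoment u L + 1764)     ∎
    where open ≡-Reasoning

147-or-171 : ∀ {q} → q ≡ 147 ⊎ q ≡ 171 → q ≡ 147 + 𝟙 (q ≟ 171) * 24
147-or-171 (inj₁ refl) = refl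
147-or-171 (inj₂ refl) = refl

-- Modulo 24, 147 ≡ 171 but 6300 ≢ 40 · 147.
∑-147-or-171≢6300 : ∀ {A : Set} (xs : List A) {f : A → ℕ} → length xs ≡ 40 →
  (∀ {x} → x ∈ xs → f x ≡ 147 ⊎ f x ≡ 171) → ∑ xs f ≢ 6300
∑-147-or-171≢6300 xs {f} |xs|≡40 values ∑≡6300 =
  from-no (24 ∣? 420) (divides m (+-cancelˡ-≡ 5880 420 (m * 24) 5880+420≡5880+m*24))
  where
  m : ℕ
  m = ∑[ x ∈ xs ] 𝟙 (f x ≟ 171)
  5880+420≡5880+m*24 : 5880 + 420 ≡ 5880 + m * 24
  5880+420≡5880+m*24 = begin
    6300                          ≡⟨ sym ∑≡6300 ⟩
    ∑ xs f                        ≡⟨ ∑-affine xs 147 24 (λ x∈ → 147-or-171 (values x∈)) ⟩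
    length xs * 147 + m * 24      ≡⟨ cong (λ n → n * 147 + m * 24) |xs|≡40 ⟩
    5880 + m * 24                 ∎
    where open ≡-Reasoning

no-cap-of-size-21 : ∀ {L} → Unique L → CapIn [] L → length L ≢ 21
no-cap-of-size-21 {L} uniq capIn@(cap , _) |L|≡21 =
  ∑-147-or-171≢6300 directions refl (λ u∈ → proj₂ (cubic u∈) (tight u∈)) (∑-secondMoment-21 uniq |L|≡21)
  where
  cubic : ∀ {u} → u ∈ directions → CubicBound (secondMoment u L) (thirdMoment u L)
  cubic = cubic-bound-sections uniq capIn |L|≡21
  tight : ∀ {u} → u ∈ directions → secondMoment u L * 19 ≡ thirdMoment u L + 1764
  tight = ∑-mono-≤-equality directions {λ u → secondMoment u L * 19} {λ u → thirdMoment u L + 1764}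
            (λ u∈ → proj₁ (cubic u∈)) (∑-sides-equal uniq cap |L|≡21)

space-cap-bound : CapBound [] 21
space-cap-bound = length<-of-no-size 21 CapIn-⊆ no-cap-of-size-21

-- The subgroup G_{81,20} and its cosets

-- Listed explicitly (and checked against x²⁰ = 1 below) so that the decisions need not recompute powers.
G-elements : List 𝔽₈₁
G-elements =
  mk c0 c1 c1 c2 ∷ mk c0 c2 c2 c1 ∷ mk c1 c0 c0 c0 ∷ mk c1 c0 c0 c1 ∷
  mk c1 c0 c1 c1 ∷ mk c1 c0 c1 c2 ∷ mk c1 c1 c0 c0 ∷ mk c1 c2 c0 c1 ∷
  mk c1 c2 c1 c0 ∷ mk c1 c2 c1 c1 ∷ mk c1 c2 c2 c0 ∷ mk c2 c0 c0 c0 ∷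
  mk c2 c0 c0 c2 ∷ mk c2 c0 c2 c1 ∷ mk c2 c0 c2 c2 ∷ mk c2 c1 c0 c2 ∷
  mk c2 c1 c1 c0 ∷ mk c2 c1 c2 c0 ∷ mk c2 c1 c2 c2 ∷ mk c2 c2 c0 c0 ∷ []

cosetList : 𝔽₈₁ → List 𝔽₈₁
cosetList h = map (h *F_) G-elements

-- α is a primitive element of 𝔽₈₁, so G_{81,20} = ⟨α⁴⟩ and its cosets are αⁱ G_{81,20}, i < 4.
α : 𝔽₈₁
α = mk c0 c1 c0 c0

cosetRep : Fin 4 → 𝔽₈₁
cosetRep i = α ^F toℕ i

IsCapList : List 𝔽₈₁ → Set
IsCapList L = All (λ a → All (λ b → a ≢ b → ¬ (-F (a +F b) ∈ L)) L) L

isCapList? : ∀ L → Dec (IsCapList L)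
isCapList? L = all? (λ a → all? (λ b → ¬? (a ≟F b) →-dec ¬? (-F (a +F b) ∈? L)) L) L

SameElements : List 𝔽₈₁ → List 𝔽₈₁ → Set
SameElements A B = All (_∈ B) A × All (_∈ A) B

opaque
  G-elements-sound : All G81,20 G-elements
  G-elements-sound = from-yes (all? (λ y → y ^F 20 ≟F 1F) G-elements)

  G-elements-complete : All (λ y → G81,20 y → y ∈ G-elements) 𝔽₈₁-elements
  G-elements-complete = from-yes (all? (λ y → (y ^F 20 ≟F 1F) →-dec (y ∈? G-elements)) 𝔽₈₁-elements)

  cosetRep≢0 : ∀ i → cosetRep i ≢ 0F
  cosetRep≢0 = from-yes (Fin.all? λ i → ¬? (cosetRep i ≟F 0F))

  cosetRep-cap : ∀ i → IsCapList (cosetList (cosetRep i))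
  cosetRep-cap = from-yes (Fin.all? (λ i → isCapList? (cosetList (cosetRep i))))

  cosetRep-unique : ∀ i → Unique (cosetList (cosetRep i))
  cosetRep-unique = from-yes (Fin.all? (λ i → allPairs? (λ x y → ¬? (x ≟F y)) (cosetList (cosetRep i))))

  cosets-cover : All (λ x → x ≢ 0F → ∃[ i ] x ∈ cosetList (cosetRep i)) 𝔽₈₁-elements
  cosets-cover = from-yes (all? (λ x → ¬? (x ≟F 0F) →-dec Fin.any? (λ i → x ∈? cosetList (cosetRep i))) 𝔽₈₁-elements)

  cosets-disjoint : ∀ i j → All (λ x → x ∈ cosetList (cosetRep j) → i ≡ j) (cosetList (cosetRep i))
  cosets-disjoint = from-yes (Fin.all? λ i → Fin.all? λ j →
    all? (λ x → (x ∈? cosetList (cosetRep j)) →-dec (i Fin.≟ j)) (cosetList (cosetRep i)))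

  coset-absorbs : ∀ i → All (λ y → SameElements (cosetList (cosetRep i *F y)) (cosetList (cosetRep i))) G-elements
  coset-absorbs = from-yes (Fin.all? λ i → all? (λ y → let A = cosetList (cosetRep i *F y); B = cosetList (cosetRep i) in
    all? (_∈? B) A ×-dec all? (_∈? A) B) G-elements)

∈G-elements⇒G81,20 : ∀ {y} → y ∈ G-elements → G81,20 y
∈G-elements⇒G81,20 = lookup G-elements-sound

G81,20⇒∈G-elements : ∀ {y} → G81,20 y → y ∈ G-elements
G81,20⇒∈G-elements {y} = lookup G-elements-complete (∈-𝔽₈₁-elements y)

∈cosetList⇒coset : ∀ {h x} → x ∈ cosetList h → coset h x
∈cosetList⇒coset {h} x∈ =
  let y , y∈G , x≡hy = ∈-map⁻ (h *F_) x∈ in y , ∈G-elements⇒G81,20 {y} y∈G , x≡hy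

coset⇒∈cosetList : ∀ {h x} → coset h x → x ∈ cosetList h
coset⇒∈cosetList {h} (y , Gy , refl) = ∈-map⁺ (h *F_) (G81,20⇒∈G-elements {y} Gy)

coset-mono : ∀ {h h′} → All (_∈ cosetList h′) (cosetList h) → ∀ {x} → coset h x → coset h′ x
coset-mono {h} {h′} h⊆h′ {x} x∈h = ∈cosetList⇒coset {h′} {x} (lookup h⊆h′ (coset⇒∈cosetList {h} {x} x∈h))

IsCapList⇒IsCapSet : ∀ {L} → IsCapList L → IsCapSet (_∈ L)
IsCapList⇒IsCapSet {L} capL a b c a∈L b∈L c∈L a≢b _ _ sum≡0 =
  lookup (lookup capL a∈L) b∈L a≢b (subst (_∈ L) (sumF≡0⇒third a b c sum≡0) c∈L)

cosetRep-covers : ∀ x → x ≢ 0F → ∃[ i ] coset (cosetRep i) x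
cosetRep-covers x x≢0 = let i , x∈ = lookup cosets-cover (∈-𝔽₈₁-elements x) x≢0 in i , ∈cosetList⇒coset {cosetRep i} {x} x∈

cosetRep-disjoint : ∀ i j x → coset (cosetRep i) x → coset (cosetRep j) x → i ≡ j
cosetRep-disjoint i j x x∈i x∈j = lookup (cosets-disjoint i j) (coset⇒∈cosetList {cosetRep i} {x} x∈i) (coset⇒∈cosetList {cosetRep j} {x} x∈j)

Coextensive : Subset → Subset → Set
Coextensive S T = ∀ x → (S x → T x) × (T x → S x)

coset-coextensive-cosetRep : ∀ h → h ≢ 0F → ∃[ i ] Coextensive (coset h) (coset (cosetRep i))
coset-coextensive-cosetRep h h≢0 = i , λ x → coset-mono {h} {cosetRep i} (proj₁ same) {x} , coset-mono {cosetRep i} {h} (proj₂ same) {x}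
  where
  i : Fin 4
  i = proj₁ (lookup cosets-cover (∈-𝔽₈₁-elements h) h≢0)
  h∈ : h ∈ cosetList (cosetRep i)
  h∈ = proj₂ (lookup cosets-cover (∈-𝔽₈₁-elements h) h≢0)
  same : SameElements (cosetList h) (cosetList (cosetRep i))
  same = subst (λ h′ → SameElements (cosetList h′) (cosetList (cosetRep i)))
               (sym (proj₂ (proj₂ (∈-map⁻ (cosetRep i *F_) h∈))))
               (lookup (coset-absorbs i) (proj₁ (proj₂ (∈-map⁻ (cosetRep i *F_) h∈))))

coset-cap-of-size-20 : ∀ h → h ≢ 0F → IsCapSet (coset h) × HasSize (coset h) 20
coset-cap-of-size-20 h h≢0 =
  cap-mono {coset h} {coset (cosetRep i)} (λ {x} → proj₁ (same x))
    (cap-mono {coset (cosetRep i)} {_∈ cosetList (cosetRep i)} (λ {x} → coset⇒∈cosetList {cosetRep i} {x})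
              (IsCapList⇒IsCapSet (cosetRep-cap i))) ,
  (cosetList (cosetRep i) , cosetRep-unique i ,
   (λ x → mk⇔ (proj₂ (same x) ∘ ∈cosetList⇒coset {cosetRep i} {x}) (coset⇒∈cosetList {cosetRep i} {x} ∘ proj₁ (same x))) ,
   length-map (cosetRep i *F_) G-elements)
  where
  i : Fin 4
  i = proj₁ (coset-coextensive-cosetRep h h≢0)
  same : Coextensive (coset h) (coset (cosetRep i))
  same = proj₂ (coset-coextensive-cosetRep h h≢0)

cap-size≤20 : ∀ (S : Subset) n → IsCapSet S → HasSize S n → n ≤ 20
cap-size≤20 S n capS (L , uniq , L⇔S , refl) =
  ≤-pred (space-cap-bound uniq (cap-mono (λ {x} → to (L⇔S x)) capS , tabulate (λ _ → [])))

mainTheorem6 :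
    -- every coset h·G (h ≠ 0) is a cap set of size 20
    (∀ h → h ≢ 0F → IsCapSet (coset h) × HasSize (coset h) 20)
    -- there are exactly four cosets, partitioning 𝔽₈₁^×
    × (Σ (Fin 4 → 𝔽₈₁) λ g →
        (∀ i → g i ≢ 0F)
        × (∀ x → x ≢ 0F → ∃[ i ] coset (g i) x)
        × (∀ i j x → coset (g i) x → coset (g j) x → i ≡ j)
        × (∀ h → h ≢ 0F → ∃[ i ] (∀ x → (coset h x → coset (g i) x) × (coset (g i) x → coset h x))))
    -- 20 is the maximum size of a cap set in 𝔽₈₁
    × (∀ (S : Subset) (n : ℕ) → IsCapSet S → HasSize S n → n ≤ 20)
mainTheorem6 =
  coset-cap-of-size-20 ,
  (cosetRep , cosetRep≢0 , cosetRep-covers , cosetRep-disjoint , coset-coextensive-cosetRep) ,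
  cap-size≤20
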